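{- Let $k,s\in\mathbb{N}$ and let $D$ be a $2ks$-linked digraph. Let $(x_1,y_1),\dots,(x_k,y_k)$ be ordered pairs of (not necessarily distinct) vertices of $D$. Then there exist internally disjoint paths $P_1,\dots,P_k$ such that $P_i$ is a directed path from $x_i$ to $y_i$ for all $i\in[k]$ and $|P_1\cup\dots\cup P_k|\le |D|/s$.
   Context: A digraph $D$ is $m$-linked if $|D|\ge 2m$ and whenever $x_1,\dots,x_m,y_1,\dots,y_m$ are $2m$ distinct vertices of $D$, there exist vertex-disjoint directed paths $P_1,\dots,P_m$ with $P_i$ from $x_i$ to $y_i$. The interior of a path is the subpath obtained by deleting its first and last vertex; two paths $P,P'$ are internally disjoint if $P\ne P'$ and their interiors share no vertices. $|P_1\cup\dots\cup P_k|$ is the number of vertices of the union of the paths, and $|D|$ is the number of vertices of $D$. -}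

module Defs where

open import Data.Nat using (ℕ; _≤_; _*_)
open import Data.Fin using (Fin; _≟_)
open import Data.List using (List; []; _∷_; length; concat; tabulate; deduplicate)
open import Data.List.Membership.Propositional using (_∈_)
open import Data.List.Relation.Unary.Unique.Propositional using (Unique)
open import Data.Product using (Σ; _×_)
open import Data.Empty using (⊥)
open import Relation.Binary.PropositionalEquality using (_≡_; _≢_)
open import Level using (suc; zero)

record Digraph : Set₁ where
  field
    n   : ℕ
    _⇒_ : Fin n → Fin n → Set

open Digraph public

Vertex : Digraph → Set
Vertex D = Fin (n D)

∣_∣ᴰ : Digraph → ℕ
∣ D ∣ᴰ = n D

data Walk (D : Digraph) : Vertex D → Vertex D → List (Vertex D) → Set where
  [_]  : ∀ x → Walk D x x (x ∷ [])
  _∷_  : ∀ {x y z vs} → _⇒_ D x y → Walk D y z vs → Walk D x z (x ∷ vs)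

IsPath : (D : Digraph) → Vertex D → Vertex D → List (Vertex D) → Set
IsPath D x y vs = Walk D x y vs × Unique vs

dropLast : ∀ {A : Set} → List A → List A
dropLast [] = []
dropLast (x ∷ []) = []
dropLast (x ∷ y ∷ ys) = x ∷ dropLast (y ∷ ys)

interior : ∀ {A : Set} → List A → List A
interior [] = []
interior (x ∷ xs) = dropLast xs

InternallyDisjoint : ∀ {D : Digraph} {k : ℕ} → (Fin k → List (Vertex D)) → Set
InternallyDisjoint {D} {k} P =
  ∀ (i j : Fin k) → i ≢ j → ∀ (v : Vertex D) → v ∈ interior (P i) → v ∈ interior (P j) → ⊥

VertexDisjoint : ∀ {D : Digraph} {m : ℕ} → (Fin m → List (Vertex D)) → Set
VertexDisjoint {D} {m} P =
  ∀ (i j : Fin m) → i ≢ j → ∀ (v : Vertex D) → v ∈ P i → v ∈ P j → ⊥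

unionSize : ∀ {D : Digraph} {k : ℕ} → (Fin k → List (Vertex D)) → ℕ
unionSize P = length (deduplicate _≟_ (concat (tabulate P)))

AllDistinct : ∀ {D : Digraph} {m : ℕ} → (Fin m → Vertex D) → (Fin m → Vertex D) → Set
AllDistinct {D} {m} x y =
  (∀ i j → i ≢ j → x i ≢ x j) × (∀ i j → i ≢ j → y i ≢ y j) × (∀ i j → x i ≢ y j)

Linked : Digraph → ℕ → Set
Linked D m =
  (2 * m ≤ ∣ D ∣ᴰ) ×
  (∀ (x y : Fin m → Vertex D) → AllDistinct {D} x y →
     Σ (Fin m → List (Vertex D)) λ P →
       (∀ i → IsPath D (x i) (y i) (P i)) × VertexDisjoint {D} P)

-- Let M = 2ks and split the M linkage requests into 2s groups of k, group g asking for
-- the pairs (x i , y i).  A blocked vertex c can be replaced by a free out- (in-)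
-- neighbour: the M-linkage routes c to a fresh vertex around the < 2M blocked ones, and
-- the second (penultimate) vertex of that path is free.  Greedily this gives 2M
-- distinct terminals a t ∈ N⁺[x i], b t ∈ N⁻[y i]; linking them disjointly, each group
-- yields internally disjoint x i–y i paths through its own k linkage paths.  The 2s
-- groups are vertex-disjoint, so some group uses at most |D|/2s vertices, and its 2k
-- endpoints add at most another |D|/2s because 4ks ≤ |D|.
module Submission where

open import Defs
open import Data.Nat using (ℕ; zero; suc; _+_; _*_; _≤_; _<_; z≤n; s≤s; s≤s⁻¹)
open import Data.Nat.Properties
  using (≤-refl; ≤-trans; ≤-reflexive; <⇒≱; ≰⇒>; n≤1+n; m≤m+n; _≤?_; +-suc; +-identityʳ;
         *-identityˡ; *-assoc; *-suc; *-distribˡ-+; +-monoˡ-≤; +-monoʳ-≤; +-mono-≤; *-monoʳ-≤;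
         *-cancelˡ-≤; suc-injective; m≤n⇒∃[o]m+o≡n; module ≤-Reasoning)
open import Data.Nat.Tactic.RingSolver using (solve-∀)
open import Data.Fin using (Fin; zero; suc; _≟_; combine; remQuot)
open import Data.Fin.Properties using (¬∀⟶∃¬; remQuot-combine; combine-injectiveˡ; combine-injectiveʳ)
open import Data.Vec using (Vec; []; _∷_; lookup)
open import Data.List using (List; []; _∷_; length; _++_; concat; tabulate; deduplicate; filter)
open import Data.List.Properties using (length-++; length-tabulate; length-removeAt′; ++-identityʳ)
open import Data.List.Membership.Propositional using (_∈_; _∉_; _─_)
open import Data.List.Membership.Propositional.Properties
  using (∈-++⁺ˡ; ∈-++⁺ʳ; ∈-++⁻; ∈-concat⁺′; ∈-concat⁻′; ∈-tabulate⁺; ∈-tabulate⁻;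
         ∈-allFin; ∈-filter⁺; ∈-filter⁻; ∈-deduplicate⁺; ∈-deduplicate⁻)
import Data.List.Membership.DecPropositional as DecMembership
open import Data.List.Relation.Unary.Any using (here; there; index)
open import Data.List.Relation.Unary.All as All using (All; []; _∷_)
open import Data.List.Relation.Unary.All.Properties using (¬Any⇒All¬) renaming (tabulate⁺ to All-tabulate⁺)
open import Data.List.Relation.Unary.AllPairs using ([]; _∷_)
import Data.List.Relation.Unary.AllPairs.Properties as AllPairs
open import Data.List.Relation.Unary.Unique.Propositional using (Unique)
open import Data.List.Relation.Unary.Unique.Propositional.Properties using (++⁺; concat⁺; allFin⁺)
open import Data.List.Relation.Unary.Unique.DecPropositional.Properties using (deduplicate-!)
open import Data.List.Relation.Binary.Subset.Propositional using (_⊆_)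
open import Data.List.Relation.Binary.Subset.Propositional.Properties using (⊆-trans; ∷⁺ʳ)
open import Data.List.Relation.Binary.Disjoint.Propositional using (Disjoint)
open import Data.Product using (Σ; ∃; ∃₂; _×_; _,_; proj₁; proj₂; map₂)
open import Data.Sum using (_⊎_; inj₁; inj₂; [_,_]′)
open import Data.Empty using (⊥-elim)
open import Function using (_∘_)
open import Relation.Nullary using (yes; no; ¬?)
open import Relation.Nullary.Decidable using (_×-dec_)
open import Relation.Binary.PropositionalEquality using (_≡_; _≢_; refl; sym; trans; cong; cong₂; subst)

module _ {A : Set} where

  ∈-─ : ∀ {x v : A} {ys} (x∈ys : x ∈ ys) → v ∈ ys → v ≢ x → v ∈ ys ─ x∈ys
  ∈-─ (here refl) (here refl) v≢x = ⊥-elim (v≢x refl)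
  ∈-─ (here refl) (there v∈ys) _ = v∈ys
  ∈-─ (there x∈ys) (here refl) _ = here refl
  ∈-─ (there x∈ys) (there v∈ys) v≢x = there (∈-─ x∈ys v∈ys v≢x)

  ∈∉⇒≢ : ∀ {x y : A} {xs} → x ∈ xs → y ∉ xs → x ≢ y
  ∈∉⇒≢ x∈xs y∉xs refl = y∉xs x∈xs

  unique-⊆⇒length≤ : ∀ {xs ys : List A} → Unique xs → xs ⊆ ys → length xs ≤ length ys
  unique-⊆⇒length≤ {[]} _ _ = z≤n
  unique-⊆⇒length≤ {x ∷ xs} {ys} (x≢xs ∷ xs!) x∷xs⊆ys = begin
    suc (length xs)         ≤⟨ s≤s (unique-⊆⇒length≤ xs! xs⊆ys─x) ⟩
    suc (length (ys ─ x∈ys)) ≡⟨ length-removeAt′ ys (index x∈ys) ⟨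
    length ys               ∎
    where
    open ≤-Reasoning
    x∈ys = x∷xs⊆ys (here refl)
    xs⊆ys─x : xs ⊆ ys ─ x∈ys
    xs⊆ys─x v∈xs = ∈-─ x∈ys (x∷xs⊆ys (there v∈xs)) (All.lookup x≢xs v∈xs ∘ sym)

  unique-⊆-∌⇒length< : ∀ {x} {xs ys : List A} → Unique xs → xs ⊆ ys → x ∈ ys → x ∉ xs →
                       length xs < length ys
  unique-⊆-∌⇒length< {xs = xs} xs! xs⊆ys x∈ys x∉xs =
    unique-⊆⇒length≤ (¬Any⇒All¬ xs x∉xs ∷ xs!) λ { (here refl) → x∈ys ; (there v∈) → xs⊆ys v∈ }

  ∈-concat-tabulate⁺ : ∀ {m} (G : Fin m → List A) {v} i → v ∈ G i → v ∈ concat (tabulate G)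
  ∈-concat-tabulate⁺ G i v∈Gi = ∈-concat⁺′ v∈Gi (∈-tabulate⁺ i)

  ∈-concat-tabulate⁻ : ∀ {m} (G : Fin m → List A) {v} → v ∈ concat (tabulate G) → ∃ λ i → v ∈ G i
  ∈-concat-tabulate⁻ G v∈
    with _ , v∈xs , xs∈ ← ∈-concat⁻′ (tabulate G) v∈
    with i , refl ← ∈-tabulate⁻ xs∈
    = i , v∈xs

  unique-concat-tabulate : ∀ {m} (G : Fin m → List A) → (∀ i → Unique (G i)) →
                           (∀ {i j} → i ≢ j → Disjoint (G i) (G j)) → Unique (concat (tabulate G))
  unique-concat-tabulate G G! G# = concat⁺ (All-tabulate⁺ G!) (AllPairs.tabulate⁺ G#)

  ∃-below-average : ∀ p → 1 ≤ p → (G : Fin p → List A) →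
                    ∃ λ i → p * length (G i) ≤ length (concat (tabulate G))
  ∃-below-average (suc zero) _ G =
    zero , ≤-reflexive (trans (*-identityˡ _) (cong length (sym (++-identityʳ (G zero)))))
  ∃-below-average (suc p@(suc _)) _ G
    with j , pGj≤ ← ∃-below-average p (s≤s z≤n) (G ∘ suc)
    rewrite length-++ (G zero) {concat (tabulate (G ∘ suc))}
    with length (G zero) ≤? length (G (suc j))
  ... | yes G₀≤Gⱼ = zero , +-monoʳ-≤ (length (G zero)) (≤-trans (*-monoʳ-≤ p G₀≤Gⱼ) pGj≤)
  ... | no G₀≰Gⱼ = suc j , +-mono-≤ (≤-trans (n≤1+n _) (≰⇒> G₀≰Gⱼ)) pGj≤

module _ {N : ℕ} where

  unique⇒length≤ : ∀ {L : List (Fin N)} → Unique L → length L ≤ N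
  unique⇒length≤ {L} L! =
    subst (length L ≤_) (length-tabulate (λ i → i)) (unique-⊆⇒length≤ L! (λ {v} _ → ∈-allFin v))

  fresh : (L : List (Fin N)) → length L < N → ∃ λ v → v ∉ L
  fresh L |L|<N = ¬∀⟶∃¬ N (_∈ L) (_∈? L) λ all∈L →
    <⇒≱ |L|<N (subst (_≤ length L) (length-tabulate (λ i → i))
                (unique-⊆⇒length≤ (allFin⁺ N) (λ {v} _ → all∈L v)))
    where open DecMembership (_≟_ {N}) using (_∈?_)

  disjoint-extension : (L : List (Fin N)) (g : ℕ) → length L + g ≤ N →
                       Σ (List (Fin N)) λ E → Unique E × Disjoint L E × length E ≡ g
  disjoint-extension L zero _ = [] , [] , (λ ()) , refl
  disjoint-extension L (suc g) room
    with E , E! , L#E , refl ← disjoint-extension L g (≤-trans (+-monoʳ-≤ (length L) (n≤1+n g)) room)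
    with v , v∉L++E ← fresh (L ++ E) (subst (_≤ N) (trans (+-suc _ _) (cong suc (sym (length-++ L)))) room)
    = v ∷ E , ¬Any⇒All¬ E (v∉L++E ∘ ∈-++⁺ʳ L) ∷ E! ,
      (λ { (w∈L , here refl) → v∉L++E (∈-++⁺ˡ w∈L) ; (w∈L , there w∈E) → L#E (w∈L , w∈E) }) , refl

module _ {A : Set} where

  ends : ∀ {m} → Vec (A × A) m → List A
  ends [] = []
  ends ((a , b) ∷ ps) = a ∷ b ∷ ends ps

  length-ends : ∀ {m} (ps : Vec (A × A) m) → length (ends ps) ≡ 2 * m
  length-ends [] = refl
  length-ends {suc m} (_ ∷ ps) = trans (cong (λ l → 2 + l) (length-ends ps)) (sym (*-suc 2 m))

  pairUp : ∀ {m} (L : List A) → length L ≡ 2 * m → Σ (Vec (A × A) m) λ ps → ends ps ≡ L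
  pairUp {zero} [] _ = [] , refl
  pairUp {suc m} (a ∷ b ∷ L) |L|≡
    with ps , refl ← pairUp {m} L (suc-injective (suc-injective (trans |L|≡ (*-suc 2 m))))
    = (a , b) ∷ ps , refl
  pairUp {suc m} (_ ∷ []) |L|≡ with () ← suc-injective (trans |L|≡ (*-suc 2 m))

  source∈ends : ∀ {m} (ps : Vec (A × A) m) t → proj₁ (lookup ps t) ∈ ends ps
  source∈ends (_ ∷ _) zero = here refl
  source∈ends (_ ∷ ps) (suc t) = there (there (source∈ends ps t))

  target∈ends : ∀ {m} (ps : Vec (A × A) m) t → proj₂ (lookup ps t) ∈ ends ps
  target∈ends (_ ∷ _) zero = there (here refl)
  target∈ends (_ ∷ ps) (suc t) = there (there (target∈ends ps t))

  ∈-ends⁻ : ∀ {m} (ps : Vec (A × A) m) {v} → v ∈ ends ps →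
            ∃ λ t → proj₁ (lookup ps t) ≡ v ⊎ proj₂ (lookup ps t) ≡ v
  ∈-ends⁻ (_ ∷ _) (here refl) = zero , inj₁ refl
  ∈-ends⁻ (_ ∷ _) (there (here refl)) = zero , inj₂ refl
  ∈-ends⁻ (_ ∷ ps) (there (there v∈)) with t , e ← ∈-ends⁻ ps v∈ = suc t , e

module _ {D : Digraph} where

  private
    V = Vertex D
    open DecMembership (_≟_ {n D}) using (_∈?_)

  source∈walk : ∀ {x y vs} → Walk D x y vs → x ∈ vs
  source∈walk [ _ ] = here refl
  source∈walk (_ ∷ _) = here refl

  target∈walk : ∀ {x y vs} → Walk D x y vs → y ∈ vs
  target∈walk [ _ ] = here refl
  target∈walk (_ ∷ w) = there (target∈walk w)

  walk-snoc : ∀ {x y z vs} → Walk D x y vs → _⇒_ D y z → Walk D x z (vs ++ z ∷ [])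
  walk-snoc [ _ ] y⇒z = y⇒z ∷ [ _ ]
  walk-snoc (e ∷ w) y⇒z = e ∷ walk-snoc w y⇒z

  path-suffix : ∀ {x y z ws} → IsPath D y z ws → x ∈ ws →
                Σ (List V) λ ws′ → IsPath D x z ws′ × ws′ ⊆ ws
  path-suffix P@([ _ ] , _) (here refl) = _ , P , λ v∈ → v∈
  path-suffix P@(_ ∷ _ , _) (here refl) = _ , P , λ v∈ → v∈
  path-suffix (_ ∷ w , _ ∷ ws!) (there x∈ws) with ws′ , P′ , ws′⊆ ← path-suffix (w , ws!) x∈ws =
    ws′ , P′ , there ∘ ws′⊆

  walk⇒path : ∀ {x y vs} → Walk D x y vs → Σ (List V) λ ws → IsPath D x y ws × ws ⊆ vs
  walk⇒path [ x ] = _ , ([ x ] , [] ∷ []) , λ v∈ → v∈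
  walk⇒path {x} (x⇒z ∷ w) with ws , (w′ , ws!) , ws⊆ ← walk⇒path w with x ∈? ws
  ... | yes x∈ws with ws′ , P′ , ws′⊆ ← path-suffix (w′ , ws!) x∈ws =
    ws′ , P′ , there ∘ ws⊆ ∘ ws′⊆
  ... | no x∉ws = x ∷ ws , (x⇒z ∷ w′ , ¬Any⇒All¬ ws x∉ws ∷ ws!) , ∷⁺ʳ x ws⊆

  ∈-dropLast-walk : ∀ {u y vs v} → Walk D u y vs → Unique vs → v ∈ dropLast vs → v ∈ vs × v ≢ y
  ∈-dropLast-walk (_ ∷ [ _ ]) (u≢ ∷ _) (here refl) = here refl , All.head u≢
  ∈-dropLast-walk (_ ∷ w@(_ ∷ _)) (u≢ ∷ _) (here refl) = here refl , All.lookup u≢ (target∈walk w)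
  ∈-dropLast-walk (_ ∷ w@(_ ∷ _)) (_ ∷ vs!) (there v∈) with v∈vs , v≢y ← ∈-dropLast-walk w vs! v∈ =
    there v∈vs , v≢y

  interior⊆ : ∀ {x y P qs} → IsPath D x y P → P ⊆ x ∷ y ∷ qs → interior P ⊆ qs
  interior⊆ (_ ∷ w , x≢ ∷ vs!) P⊆ v∈
    with v∈vs , v≢y ← ∈-dropLast-walk w vs! v∈
    with P⊆ (there v∈vs)
  ... | here refl = ⊥-elim (All.lookup x≢ v∈vs refl)
  ... | there (here v≡y) = ⊥-elim (v≢y v≡y)
  ... | there (there v∈qs) = v∈qs

  successor-on-path : ∀ {x y P} → IsPath D x y P → x ≢ y → Σ V λ v → _⇒_ D x v × v ∈ P × v ≢ x
  successor-on-path ([ _ ] , _) x≢y = ⊥-elim (x≢y refl)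
  successor-on-path (x⇒v ∷ w , x≢ ∷ _) _ =
    _ , x⇒v , there (source∈walk w) , All.lookup x≢ (source∈walk w) ∘ sym

  predecessor-on-path : ∀ {x y P} → IsPath D x y P → x ≢ y → Σ V λ v → _⇒_ D v y × v ∈ P × v ≢ y
  predecessor-on-path ([ _ ] , _) x≢y = ⊥-elim (x≢y refl)
  predecessor-on-path (x⇒y ∷ [ _ ] , _) x≢y = _ , x⇒y , here refl , x≢y
  predecessor-on-path (_ ∷ w@(_ ∷ w′) , _ ∷ vs!@(z≢ ∷ _)) _
    with v , v⇒y , v∈ , v≢y ← predecessor-on-path (w , vs!) (All.lookup z≢ (target∈walk w′)) =
    v , v⇒y , there v∈ , v≢y

  N⁺[_] N⁻[_] : V → V → Set
  N⁺[ c ] v = v ≡ c ⊎ _⇒_ D c v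
  N⁻[ c ] v = v ≡ c ⊎ _⇒_ D v c

  extend-to-target : ∀ {u w y vs} → N⁻[ y ] w → Walk D u w vs →
                     Σ (List V) λ vs′ → Walk D u y vs′ × vs′ ⊆ y ∷ vs
  extend-to-target (inj₁ refl) W = _ , W , there
  extend-to-target {vs = vs} (inj₂ w⇒y) W =
    _ , walk-snoc W w⇒y , [ there , (λ { (here refl) → here refl }) ]′ ∘ ∈-++⁻ vs

  extend-from-source : ∀ {x u w vs} → N⁺[ x ] u → Walk D u w vs →
                       Σ (List V) λ vs′ → Walk D x w vs′ × vs′ ⊆ x ∷ vs
  extend-from-source (inj₁ refl) W = _ , W , there
  extend-from-source (inj₂ x⇒u) W = _ , x⇒u ∷ W , λ v∈ → v∈

  route : ∀ {x y u w qs} → N⁺[ x ] u → N⁻[ y ] w → Walk D u w qs →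
          Σ (List V) λ P → IsPath D x y P × P ⊆ x ∷ y ∷ qs
  route {x} x→u w→y W
    with _ , W′ , vs⊆ ← extend-to-target w→y W
    with _ , W″ , vs′⊆ ← extend-from-source x→u W′
    with P , P-path , P⊆ ← walk⇒path W″
    = P , P-path , ⊆-trans P⊆ (⊆-trans vs′⊆ (∷⁺ʳ x vs⊆))

  ends-AllDistinct : ∀ {m} (ps : Vec (V × V) m) → Unique (ends ps) →
                     AllDistinct {D} (proj₁ ∘ lookup ps) (proj₂ ∘ lookup ps)
  ends-AllDistinct ps ps! = sources ps ps! , targets ps ps! , sources≢targets ps ps!
    where
    sources : ∀ {m} (ps : Vec (V × V) m) → Unique (ends ps) → ∀ i j → i ≢ j →
              proj₁ (lookup ps i) ≢ proj₁ (lookup ps j)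
    sources (_ ∷ _) _ zero zero i≢j = ⊥-elim (i≢j refl)
    sources (_ ∷ ps) (a≢ ∷ _) zero (suc j) _ = All.lookup a≢ (there (source∈ends ps j))
    sources (_ ∷ ps) (a≢ ∷ _) (suc i) zero _ = All.lookup a≢ (there (source∈ends ps i)) ∘ sym
    sources (_ ∷ ps) (_ ∷ _ ∷ ps!) (suc i) (suc j) i≢j = sources ps ps! i j (i≢j ∘ cong suc)

    targets : ∀ {m} (ps : Vec (V × V) m) → Unique (ends ps) → ∀ i j → i ≢ j →
              proj₂ (lookup ps i) ≢ proj₂ (lookup ps j)
    targets (_ ∷ _) _ zero zero i≢j = ⊥-elim (i≢j refl)
    targets (_ ∷ ps) (_ ∷ b≢ ∷ _) zero (suc j) _ = All.lookup b≢ (target∈ends ps j)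
    targets (_ ∷ ps) (_ ∷ b≢ ∷ _) (suc i) zero _ = All.lookup b≢ (target∈ends ps i) ∘ sym
    targets (_ ∷ ps) (_ ∷ _ ∷ ps!) (suc i) (suc j) i≢j = targets ps ps! i j (i≢j ∘ cong suc)

    sources≢targets : ∀ {m} (ps : Vec (V × V) m) → Unique (ends ps) → ∀ i j →
                      proj₁ (lookup ps i) ≢ proj₂ (lookup ps j)
    sources≢targets (_ ∷ _) (a≢ ∷ _) zero zero = All.head a≢
    sources≢targets (_ ∷ ps) (a≢ ∷ _) zero (suc j) = All.lookup a≢ (there (target∈ends ps j))
    sources≢targets (_ ∷ ps) (_ ∷ b≢ ∷ _) (suc i) zero = All.lookup b≢ (source∈ends ps i) ∘ sym
    sources≢targets (_ ∷ ps) (_ ∷ _ ∷ ps!) (suc i) (suc j) = sources≢targets ps ps! i j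

  path-meets-ends-only-at-own : ∀ {m} (ps : Vec (V × V) m) (Q : Fin m → List V) →
    (∀ t → IsPath D (proj₁ (lookup ps t)) (proj₂ (lookup ps t)) (Q t)) → VertexDisjoint {D} Q →
    ∀ t {v} → v ∈ Q t → v ∈ ends ps → proj₁ (lookup ps t) ≡ v ⊎ proj₂ (lookup ps t) ≡ v
  path-meets-ends-only-at-own ps Q paths Q# t v∈Qt v∈ends with ∈-ends⁻ ps v∈ends
  ... | t′ , end with t ≟ t′
  ...   | yes refl = end
  ...   | no t≢t′ = ⊥-elim (Q# t t′ t≢t′ _ v∈Qt (v∈Qt′ end))
    where
    v∈Qt′ : ∀ {v} → proj₁ (lookup ps t′) ≡ v ⊎ proj₂ (lookup ps t′) ≡ v → v ∈ Q t′
    v∈Qt′ (inj₁ refl) = source∈walk (proj₁ (paths t′))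
    v∈Qt′ (inj₂ refl) = target∈walk (proj₁ (paths t′))

  without : V → V → List V → List V
  without a b F = deduplicate _≟_ (filter (λ v → ¬? (v ≟ a) ×-dec ¬? (v ≟ b)) F)

  ∈-without⁺ : ∀ {a b v} F → v ∈ F → v ≢ a → v ≢ b → v ∈ without a b F
  ∈-without⁺ F v∈F v≢a v≢b = ∈-deduplicate⁺ _≟_ (∈-filter⁺ _ v∈F (v≢a , v≢b))

  ∈-without⁻ : ∀ {a b v} F → v ∈ without a b F → v ∈ F × v ≢ a × v ≢ b
  ∈-without⁻ F v∈ = ∈-filter⁻ _ {xs = F} (∈-deduplicate⁻ _≟_ _ v∈)

  without-shrinks : ∀ {a b c} F → c ∈ F → c ≡ a ⊎ c ≡ b → length (without a b F) < length F
  without-shrinks F c∈F c∈ab =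
    unique-⊆-∌⇒length< (deduplicate-! _≟_ _) (proj₁ ∘ ∈-without⁻ F) c∈F λ c∈ →
      let _ , c≢a , c≢b = ∈-without⁻ F c∈ in [ c≢a , c≢b ]′ c∈ab

  unique-without : ∀ {a b} → a ≢ b → ∀ F → Unique (a ∷ b ∷ without a b F)
  unique-without {a} {b} a≢b F =
    ¬Any⇒All¬ _ (λ { (here a≡b) → a≢b a≡b ; (there a∈) → proj₁ (proj₂ (∈-without⁻ F a∈)) refl }) ∷
    ¬Any⇒All¬ _ (λ b∈ → proj₂ (proj₂ (∈-without⁻ F b∈)) refl) ∷
    deduplicate-! _≟_ _

  ∉-without⇒endpoint : ∀ {a b v} F → v ∈ F → v ∉ without a b F → v ≡ a ⊎ v ≡ b
  ∉-without⇒endpoint {a} {b} {v} F v∈F v∉ with v ≟ a | v ≟ b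
  ... | yes v≡a | _ = inj₁ v≡a
  ... | no _ | yes v≡b = inj₂ v≡b
  ... | no v≢a | no v≢b = ⊥-elim (v∉ (∈-without⁺ F v∈F v≢a v≢b))

  -- The vertices of L are terminals of the other paths of the linkage, so the path
  -- linking a to b avoids them.
  path-avoiding-exact : ∀ {M} → Linked D (suc M) → (a b : V) (L : List V) → Unique (a ∷ b ∷ L) →
                        length L ≡ 2 * M → Σ (List V) λ P → IsPath D a b P × Disjoint P L
  path-avoiding-exact (_ , link) a b L L!@(a≢ ∷ b≢ ∷ _) |L|≡ = Q zero , paths zero , P#L
    where
    ps = (a , b) ∷ proj₁ (pairUp L |L|≡)
    ends≡ : ends ps ≡ a ∷ b ∷ L
    ends≡ = cong (λ l → a ∷ b ∷ l) (proj₂ (pairUp L |L|≡))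
    linkage = link (proj₁ ∘ lookup ps) (proj₂ ∘ lookup ps) (ends-AllDistinct ps (subst Unique (sym ends≡) L!))
    Q = proj₁ linkage
    paths = proj₁ (proj₂ linkage)
    P#L : Disjoint (Q zero) L
    P#L {v} (v∈P , v∈L)
      with path-meets-ends-only-at-own ps Q paths (proj₂ (proj₂ linkage)) zero v∈P
             (subst (v ∈_) (sym ends≡) (there (there v∈L)))
    ... | inj₁ refl = All.lookup a≢ (there v∈L) refl
    ... | inj₂ refl = All.lookup b≢ v∈L refl

  path-avoiding : ∀ {M} → Linked D M → (a b : V) → a ≢ b → (F : List V) →
                  2 + length (without a b F) ≤ 2 * M →
                  Σ (List V) λ P → IsPath D a b P × (∀ {v} → v ∈ P → v ∈ F → v ≡ a ⊎ v ≡ b)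
  path-avoiding {suc M} lk a b a≢b F room
    with g , |R|+g≡ ←
           m≤n⇒∃[o]m+o≡n (s≤s⁻¹ (s≤s⁻¹ (subst (2 + length (without a b F) ≤_) (*-suc 2 M) room)))
    with E , E! , R#E , refl ← disjoint-extension (a ∷ b ∷ without a b F) g
           (subst (_≤ n D) (trans (*-suc 2 M) (cong (2 +_) (sym |R|+g≡))) (proj₁ lk))
    with P , P-path , P#L ← path-avoiding-exact lk a b (without a b F ++ E)
           (++⁺ (unique-without a≢b F) E! R#E) (trans (length-++ (without a b F)) |R|+g≡)
    = P , P-path , λ v∈P v∈F → ∉-without⇒endpoint F v∈F (λ v∈R → P#L (v∈P , ∈-++⁺ˡ v∈R))

  out-neighbour-avoiding : ∀ {M} → Linked D M → (c : V) (F : List V) → length F < 2 * M →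
                           Σ V λ v → v ∉ F × N⁺[ c ] v
  out-neighbour-avoiding lk c F |F|<2M with c ∈? F
  ... | no c∉F = c , c∉F , inj₁ refl
  ... | yes c∈F
    with y , y∉F ← fresh F (≤-trans |F|<2M (proj₁ lk))
    with P , P-path , P∩F ← path-avoiding lk c y (∈∉⇒≢ c∈F y∉F) F
                              (≤-trans (s≤s (without-shrinks F c∈F (inj₁ refl))) |F|<2M)
    with v , c⇒v , v∈P , v≢c ← successor-on-path P-path (∈∉⇒≢ c∈F y∉F)
    = v , (λ v∈F → [ v≢c , ∈∉⇒≢ v∈F y∉F ]′ (P∩F v∈P v∈F)) , inj₂ c⇒v

  in-neighbour-avoiding : ∀ {M} → Linked D M → (c : V) (F : List V) → length F < 2 * M →
                          Σ V λ v → v ∉ F × N⁻[ c ] v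
  in-neighbour-avoiding lk c F |F|<2M with c ∈? F
  ... | no c∉F = c , c∉F , inj₁ refl
  ... | yes c∈F
    with y , y∉F ← fresh F (≤-trans |F|<2M (proj₁ lk))
    with P , P-path , P∩F ← path-avoiding lk y c (∈∉⇒≢ c∈F y∉F ∘ sym) F
                              (≤-trans (s≤s (without-shrinks F c∈F (inj₂ refl))) |F|<2M)
    with v , v⇒c , v∈P , v≢c ← predecessor-on-path P-path (∈∉⇒≢ c∈F y∉F ∘ sym)
    = v , (λ v∈F → [ ∈∉⇒≢ v∈F y∉F , v≢c ]′ (P∩F v∈P v∈F)) , inj₂ v⇒c

  near-pairs : ∀ {M m} → Linked D M → m ≤ M → (x y : Fin m → V) →
               Σ (Vec (V × V) m) λ ps → Unique (ends ps) ×
                 (∀ t → N⁺[ x t ] (proj₁ (lookup ps t)) × N⁻[ y t ] (proj₂ (lookup ps t)))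
  near-pairs {m = zero} _ _ _ _ = [] , [] , λ ()
  near-pairs {M} {suc m} lk m<M x y
    with ps , ps! , near ← near-pairs lk (≤-trans (n≤1+n m) m<M) (x ∘ suc) (y ∘ suc)
    with room ← subst (_≤ 2 * M) (trans (*-suc 2 m) (cong (2 +_) (sym (length-ends ps)))) (*-monoʳ-≤ 2 m<M)
    with a , a∉ , x→a ← out-neighbour-avoiding lk (x zero) (ends ps) (≤-trans (n≤1+n _) room)
    with b , b∉ , b→y ← in-neighbour-avoiding lk (y zero) (a ∷ ends ps) room
    = (a , b) ∷ ps ,
      ¬Any⇒All¬ (b ∷ ends ps) (λ { (here a≡b) → b∉ (here (sym a≡b)) ; (there a∈) → a∉ a∈ }) ∷
      ¬Any⇒All¬ (ends ps) (b∉ ∘ there) ∷ ps! ,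
      λ { zero → x→a , b→y ; (suc t) → near t }

  near-linkage : ∀ {M} → Linked D M → (x y : Fin M → V) →
                 Σ (Fin M → List V) λ Q → VertexDisjoint {D} Q ×
                   (∀ t → ∃₂ λ u w → N⁺[ x t ] u × N⁻[ y t ] w × IsPath D u w (Q t))
  near-linkage lk x y
    with ps , ps! , near ← near-pairs lk ≤-refl x y
    with Q , paths , Q# ← proj₂ lk _ _ (ends-AllDistinct ps ps!)
    = Q , Q# , λ t → _ , _ , proj₁ (near t) , proj₂ (near t) , paths t

  unionSize≤ : ∀ {k} (P : Fin k → List V) (L : List V) → (∀ i → P i ⊆ L) → unionSize {D} P ≤ length L
  unionSize≤ P L P⊆L = unique-⊆⇒length≤ (deduplicate-! _≟_ _) λ v∈ →
    let i , v∈Pi = ∈-concat-tabulate⁻ P (∈-deduplicate⁻ _≟_ _ v∈) in P⊆L i v∈Pi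

  module _ {k} {x y : Fin k → V} {P C : Fin k → List V} (P⊆ : ∀ i → P i ⊆ x i ∷ y i ∷ C i) where

    internallyDisjoint-via-cores : (∀ i → IsPath D (x i) (y i) (P i)) → VertexDisjoint {D} C →
                                   InternallyDisjoint {D} P
    internallyDisjoint-via-cores paths C# i j i≢j v v∈i v∈j =
      C# i j i≢j v (interior⊆ (paths i) (P⊆ i) v∈i) (interior⊆ (paths j) (P⊆ j) v∈j)

    unionSize-via-cores : unionSize {D} P ≤ length (concat (tabulate C)) + 2 * k
    unionSize-via-cores = begin
      unionSize {D} P                                 ≤⟨ unionSize≤ P (C* ++ tabulate x ++ tabulate y) P⊆L ⟩
      length (C* ++ tabulate x ++ tabulate y)         ≡⟨ length-++ C* ⟩
      length C* + length (tabulate x ++ tabulate y)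
        ≡⟨ cong (length C* +_)
             (trans (length-++ (tabulate x)) (cong₂ _+_ (length-tabulate x) (length-tabulate y))) ⟩
      length C* + (k + k)                             ≡⟨ cong (λ l → length C* + (k + l)) (+-identityʳ k) ⟨
      length C* + 2 * k                               ∎
      where
      open ≤-Reasoning
      C* = concat (tabulate C)
      P⊆L : ∀ i → P i ⊆ C* ++ tabulate x ++ tabulate y
      P⊆L i v∈ with P⊆ i v∈
      ... | here refl = ∈-++⁺ʳ C* (∈-++⁺ˡ (∈-tabulate⁺ i))
      ... | there (here refl) = ∈-++⁺ʳ C* (∈-++⁺ʳ (tabulate x) (∈-tabulate⁺ i))
      ... | there (there v∈C) = ∈-++⁺ˡ (∈-concat-tabulate⁺ C i v∈C)

  unique-regrouped : ∀ {p k} (Q : Fin (p * k) → List V) → (∀ t → Unique (Q t)) → VertexDisjoint {D} Q →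
                     Unique (concat (tabulate λ g → concat (tabulate λ i → Q (combine {p} g i))))
  unique-regrouped {p} {k} Q Q! Q# =
    unique-concat-tabulate W
      (λ g → unique-concat-tabulate (Q ∘ combine {p} g) (Q! ∘ combine {p} g) (within g)) across
    where
    W : Fin p → List V
    W g = concat (tabulate (Q ∘ combine {p} g))
    within : ∀ g {i j} → i ≢ j → Disjoint (Q (combine {p} g i)) (Q (combine {p} g j))
    within g {i} {j} i≢j (v∈i , v∈j) = Q# _ _ (i≢j ∘ combine-injectiveʳ g i g j) _ v∈i v∈j
    across : ∀ {g h} → g ≢ h → Disjoint (W g) (W h)
    across {g} {h} g≢h (v∈g , v∈h)
      with i , v∈i ← ∈-concat-tabulate⁻ (Q ∘ combine {p} g) v∈g
      with j , v∈j ← ∈-concat-tabulate⁻ (Q ∘ combine h) v∈h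
      = Q# _ _ (g≢h ∘ combine-injectiveˡ g i h j) _ v∈i v∈j

  grouped-routings : ∀ {p k} → Linked D (p * k) → (x y : Fin k → V) →
    Σ (Fin p → Fin k → List V) λ C →
      length (concat (tabulate λ g → concat (tabulate (C g)))) ≤ n D × (∀ g → VertexDisjoint {D} (C g)) ×
      (∀ g i → Σ (List V) λ P → IsPath D (x i) (y i) P × P ⊆ x i ∷ y i ∷ C g i)
  grouped-routings {p} {k} lk x y = C , unique⇒length≤ (unique-regrouped {p} Q Q! Q#) , C# , routes
    where
    member : Fin (p * k) → Fin k
    member t = proj₂ (remQuot {p} k t)

    member-combine : ∀ g i → member (combine g i) ≡ i
    member-combine g i = cong proj₂ (remQuot-combine g i)

    linkage = near-linkage lk (x ∘ member) (y ∘ member)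
    Q = proj₁ linkage
    Q# = proj₁ (proj₂ linkage)
    Q-near = proj₂ (proj₂ linkage)

    Q! : ∀ t → Unique (Q t)
    Q! t with _ , _ , _ , _ , _ , Qt! ← Q-near t = Qt!

    C : Fin p → Fin k → List V
    C g = Q ∘ combine g

    C# : ∀ g → VertexDisjoint {D} (C g)
    C# g i j i≢j = Q# _ _ (i≢j ∘ combine-injectiveʳ g i g j)

    routes : ∀ g i → Σ (List V) λ P → IsPath D (x i) (y i) P × P ⊆ x i ∷ y i ∷ C g i
    routes g i with u , w , x→u , w→y , Q-path ← Q-near (combine g i) =
      route (subst (λ j → N⁺[ x j ] u) (member-combine g i) x→u)
            (subst (λ j → N⁻[ y j ] w) (member-combine g i) w→y) (proj₁ Q-path)

  short-linkage : ∀ k p → 1 ≤ p → Linked D (p * k) → (x y : Fin k → V) →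
    Σ (Fin k → List V) λ P → (∀ i → IsPath D (x i) (y i) (P i)) × InternallyDisjoint {D} P ×
      p * unionSize {D} P ≤ n D + p * (2 * k)
  short-linkage k p p≥1 lk x y
    with C , total≤n , C# , routes ← grouped-routings {p} lk x y
    with g , p*|Cg|≤total ← ∃-below-average p p≥1 (λ g → concat (tabulate (C g)))
    = P , paths , internallyDisjoint-via-cores P⊆ paths (C# g) , (begin
      p * unionSize {D} P                                     ≤⟨ *-monoʳ-≤ p (unionSize-via-cores P⊆) ⟩
      p * (length (concat (tabulate (C g))) + 2 * k)          ≡⟨ *-distribˡ-+ p _ (2 * k) ⟩
      p * length (concat (tabulate (C g))) + p * (2 * k)
        ≤⟨ +-monoˡ-≤ (p * (2 * k)) (≤-trans p*|Cg|≤total total≤n) ⟩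
      n D + p * (2 * k)                                       ∎)
    where
    open ≤-Reasoning
    P : Fin k → List V
    P i = proj₁ (routes g i)
    paths : ∀ i → IsPath D (x i) (y i) (P i)
    paths i = proj₁ (proj₂ (routes g i))
    P⊆ : ∀ i → P i ⊆ x i ∷ y i ∷ C g i
    P⊆ i = proj₂ (proj₂ (routes g i))

2ks≡2sk : ∀ k s → 2 * k * s ≡ 2 * s * k
2ks≡2sk = solve-∀

absorb-excess : ∀ k s u m → 2 * s * u ≤ m + 2 * s * (2 * k) → 2 * (2 * k * s) ≤ m → s * u ≤ m
absorb-excess k s u m bound 4ks≤m = *-cancelˡ-≤ 2 (begin
  2 * (s * u)            ≡⟨ *-assoc 2 s u ⟨
  2 * s * u              ≤⟨ bound ⟩
  m + 2 * s * (2 * k)    ≡⟨ cong (m +_) (reorder k s) ⟩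
  m + 2 * (2 * k * s)    ≤⟨ +-monoʳ-≤ m 4ks≤m ⟩
  m + m                  ≡⟨ cong (m +_) (+-identityʳ m) ⟨
  2 * m                  ∎)
  where
  open ≤-Reasoning
  reorder : ∀ k s → 2 * s * (2 * k) ≡ 2 * (2 * k * s)
  reorder = solve-∀

lemma4p8 : (k s : ℕ) → 1 ≤ s → (D : Digraph) → Linked D (2 * k * s) →
    (x y : Fin k → Vertex D) →
    Σ (Fin k → List (Vertex D)) λ P →
      (∀ i → IsPath D (x i) (y i) (P i)) × InternallyDisjoint {D} P ×
      (s * unionSize {D} P ≤ ∣ D ∣ᴰ)
lemma4p8 k s s≥1 D lk x y =
  map₂ (map₂ (map₂ λ bound → absorb-excess k s _ (n D) bound (proj₁ lk)))
       (short-linkage k (2 * s) (≤-trans s≥1 (m≤m+n s _)) (subst (Linked D) (2ks≡2sk k s) lk) x y)
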